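{- Assume the setting below. Then for each $0\le i\le d$, $A_i$ is a polynomial in $A$ of degree $i$; $J=f(A)$ for a polynomial $f$ of degree $d$; and the minimal polynomial of $A$ is $\mu(x)=\left(\prod_{i=1}^d c_i\right) f(x)(x-k)$, which has degree $d+1$.
   Context: Setting: Let $d\ge 2$ and $k\ge 3$ be integers. Let numbers $c_i,a_i,b_i$ ($-1\le i\le d+1$) satisfy $c_{ -1}=c_0=0$, $c_1=1$, $c_{d+1}=0$, $b_{ -1}=0$, $b_0=k$, $b_d=b_{d+1}=0$, $a_0=0$, $k=c_i+a_i+b_i$ for all $-1\le i\le d+1$, $1=c_1\le c_2\le\cdots\le c_d\le k$ and $k=b_0\ge b_1\ge\cdots\ge b_{d-1}\ge 1$. Let $A_{ -1}=\mathbf 0, A_0,A_1,\dots,A_d,A_{d+1}=\mathbf 0$ be $n\times n$ matrices with $A_0=I$, $A_1=A$, $A\mathbf j=k\mathbf j$ (where $\mathbf j$ is the all-ones column vector), the minimal polynomial of $A$ has degree at least $d+1$, $J=A_0+A_1+\cdots+A_d$ (with $J$ the all-ones matrix), and $AA_i=b_{i-1}A_{i-1}+a_iA_i+c_{i+1}A_{i+1}$ for $0\le i\le d$. -}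

module Defs where

open import Level using (Level; _⊔_) renaming (suc to lsuc)
open import Algebra.Bundles using (CommutativeRing)
open import Relation.Binary.Core using (Rel)
open import Relation.Binary.Structures using (IsTotalOrder)
open import Relation.Nullary using (¬_)
open import Data.Product using (∃; _×_)
open import Data.Nat as ℕ using (ℕ; zero; suc)
open import Data.Fin using (Fin; zero; suc)
open import Data.List using (List; []; _∷_)

-- An ordered field (the paper works over the real numbers, which form one).
record OrderedField (c ℓ₁ ℓ₂ : Level) : Set (lsuc (c ⊔ ℓ₁ ⊔ ℓ₂)) where
  field
    commutativeRing : CommutativeRing c ℓ₁
  open CommutativeRing commutativeRing public
  field
    _≤_          : Rel Carrier ℓ₂
    isTotalOrder : IsTotalOrder _≈_ _≤_
    +-monoʳ-≤    : ∀ {x y} z → x ≤ y → (x + z) ≤ (y + z)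
    *-nonneg     : ∀ {x y} → 0# ≤ x → 0# ≤ y → 0# ≤ (x * y)
    0≉1          : ¬ (0# ≈ 1#)
    *-inverse    : ∀ x → ¬ (x ≈ 0#) → ∃ λ y → (x * y) ≈ 1#

module Over {c ℓ₁ ℓ₂} (F : OrderedField c ℓ₁ ℓ₂) where
  open OrderedField F public hiding (zero)

  ι : ℕ → Carrier
  ι zero    = 0#
  ι (suc m) = 1# + ι m

  Σ : ∀ m → (Fin m → Carrier) → Carrier
  Σ zero    g = 0#
  Σ (suc m) g = g zero + Σ m (λ j → g (suc j))

  Πℕ : ℕ → (ℕ → Carrier) → Carrier
  Πℕ zero    g = 1#
  Πℕ (suc m) g = g m * Πℕ m g

  Mat : ℕ → Set c
  Mat n = Fin n → Fin n → Carrier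

  _≈ₘ_ : ∀ {n} → Mat n → Mat n → Set ℓ₁
  M ≈ₘ N = ∀ r s → M r s ≈ N r s

  _+ₘ_ : ∀ {n} → Mat n → Mat n → Mat n
  (M +ₘ N) r s = M r s + N r s

  _*ₘ_ : ∀ {n} → Mat n → Mat n → Mat n
  _*ₘ_ {n} M N r s = Σ n (λ t → M r t * N t s)

  _·ₘ_ : ∀ {n} → Carrier → Mat n → Mat n
  (x ·ₘ M) r s = x * M r s

  0ₘ : ∀ {n} → Mat n
  0ₘ r s = 0#

  Iₘ : ∀ {n} → Mat n
  Iₘ zero    zero    = 1#
  Iₘ zero    (suc s) = 0#
  Iₘ (suc r) zero    = 0#
  Iₘ (suc r) (suc s) = Iₘ r s

  Jₘ : ∀ {n} → Mat n
  Jₘ r s = 1#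

  -- polynomials as coefficient lists, constant term first
  Poly : Set c
  Poly = List Carrier

  coeff : Poly → ℕ → Carrier
  coeff []      j       = 0#
  coeff (x ∷ p) zero    = x
  coeff (x ∷ p) (suc j) = coeff p j

  Degree : Poly → ℕ → Set ℓ₁
  Degree p m = (¬ (coeff p m ≈ 0#)) × (∀ j → m ℕ.< j → coeff p j ≈ 0#)

  _+ₚ_ : Poly → Poly → Poly
  []      +ₚ q       = q
  (x ∷ p) +ₚ []      = x ∷ p
  (x ∷ p) +ₚ (y ∷ q) = (x + y) ∷ (p +ₚ q)

  _·ₚ_ : Carrier → Poly → Poly
  x ·ₚ []      = []
  x ·ₚ (y ∷ p) = (x * y) ∷ (x ·ₚ p)

  _*ₚ_ : Poly → Poly → Poly
  []      *ₚ q = []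
  (x ∷ p) *ₚ q = (x ·ₚ q) +ₚ (0# ∷ (p *ₚ q))

  X-_ : Carrier → Poly
  X- x = (- x) ∷ 1# ∷ []

  evalₘ : ∀ {n} → Poly → Mat n → Mat n
  evalₘ []      M = 0ₘ
  evalₘ (x ∷ p) M = (x ·ₘ Iₘ) +ₘ (M *ₘ evalₘ p M)

  IsMinPoly : ∀ {n} → Mat n → Poly → ℕ → Set (c ⊔ ℓ₁)
  IsMinPoly M μ m =
    Degree μ m × (coeff μ m ≈ 1#) × (evalₘ μ M ≈ₘ 0ₘ) ×
    (∀ p m′ → Degree p m′ → evalₘ p M ≈ₘ 0ₘ → m ℕ.≤ m′)

  MinPolyDegAtLeast : ∀ {n} → Mat n → ℕ → Set (c ⊔ ℓ₁)
  MinPolyDegAtLeast M m = ∀ p m′ → Degree p m′ → evalₘ p M ≈ₘ 0ₘ → m ℕ.≤ m′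

-- Solving the three-term recurrence A Aᵢ₊₁ = bᵢ Aᵢ + aᵢ₊₁ Aᵢ₊₁ + cᵢ₊₂ Aᵢ₊₂ for
-- Aᵢ₊₂ (the cᵢ are ≥ 1, hence invertible) defines polynomials Pᵢ with
-- Pᵢ(A) = Aᵢ, of degree i and leading coefficient 1 / (c₁ ⋯ cᵢ).  Their sum
-- f = P₀ + ⋯ + P_d then has degree d and f(A) = J.  Since A J = k J, the
-- polynomial (c₁ ⋯ c_d) f(x) (x - k) is monic of degree d + 1 and kills A, so
-- it is the minimal polynomial, whose degree is at least d + 1 by assumption.
module Submission where

open import Defs
open import Data.Nat using (ℕ; zero; suc; _∸_; z≤n; s≤s; _≤?_) renaming (_≤_ to _≤ℕ_; _<_ to _<ℕ_)
open import Data.Fin using (Fin; toℕ)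
open import Data.Product using (∃; _×_; _,_; proj₁; proj₂)
import Data.Nat.Properties as ℕ
import Data.Fin as Fin
import Data.Fin.Properties as Fin
open import Data.List using ([]; _∷_)
open import Relation.Nullary using (¬_; yes; no; contradiction)
open import Relation.Unary using (Decidable)
import Relation.Binary.PropositionalEquality as ≡
open import Relation.Binary.Structures using (IsTotalOrder)

module OrderedFieldProperties {ℓc ℓ₁ ℓ₂} (F : OrderedField ℓc ℓ₁ ℓ₂) where
  open Over F
  open import Algebra.Properties.Ring ring using (-1*x≈-x; -‿involutive)
  open IsTotalOrder isTotalOrder using (antisym; ≤-respˡ-≈; ≤-respʳ-≈)

  1≰0 : ¬ (1# ≤ 0#)
  1≰0 1≤0 = 0≉1 (antisym 0≤1 1≤0)
    where
    0≤-1 : 0# ≤ (- 1#)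
    0≤-1 = ≤-respʳ-≈ (+-identityˡ _) (≤-respˡ-≈ (-‿inverseʳ 1#) (+-monoʳ-≤ (- 1#) 1≤0))
    0≤1 : 0# ≤ 1#
    0≤1 = ≤-respʳ-≈ (trans (-1*x≈-x (- 1#)) (-‿involutive 1#)) (*-nonneg 0≤-1 0≤-1)

  1≤x⇒x≉0 : ∀ {x} → 1# ≤ x → ¬ (x ≈ 0#)
  1≤x⇒x≉0 1≤x x≈0 = 1≰0 (≤-respʳ-≈ x≈0 1≤x)

  inverseOn : ∀ {p} {P : ℕ → Set p} → Decidable P → (x : ℕ → Carrier) →
              (∀ i → P i → ¬ (x i ≈ 0#)) → ∃ λ y → ∀ i → P i → x i * y i ≈ 1#
  inverseOn {P = P} P? x x≉0 = y , x*y≈1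
    where
    y : ℕ → Carrier
    y i with P? i
    ... | yes Pi = proj₁ (*-inverse (x i) (x≉0 i Pi))
    ... | no _   = 0#
    x*y≈1 : ∀ i → P i → x i * y i ≈ 1#
    x*y≈1 i Pi with P? i
    ... | yes Pi′ = proj₂ (*-inverse (x i) (x≉0 i Pi′))
    ... | no ¬Pi  = contradiction Pi ¬Pi

module MatrixProperties {ℓc ℓ₁ ℓ₂} (F : OrderedField ℓc ℓ₁ ℓ₂) where
  open Over F
  open import Algebra.Properties.Semiring.Sum semiring
    using (sum; sum-cong-≋; ∑-distrib-+; *-distribˡ-sum; sum-replicate-zero; sum-init-last)
  open import Algebra.Properties.CommutativeSemigroup *-commutativeSemigroup using (x∙yz≈y∙xz)

  Σ≡sum : ∀ m (g : Fin m → Carrier) → Σ m g ≡.≡ sum g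
  Σ≡sum zero    g = ≡.refl
  Σ≡sum (suc m) g = ≡.cong (g Fin.zero +_) (Σ≡sum m (λ t → g (Fin.suc t)))

  Σ-cong : ∀ m {g h : Fin m → Carrier} → (∀ t → g t ≈ h t) → Σ m g ≈ Σ m h
  Σ-cong m {g} {h} g≈h rewrite Σ≡sum m g | Σ≡sum m h = sum-cong-≋ g≈h

  Σ-distrib-+ : ∀ m (g h : Fin m → Carrier) → Σ m (λ t → g t + h t) ≈ Σ m g + Σ m h
  Σ-distrib-+ m g h
    rewrite Σ≡sum m (λ t → g t + h t) | Σ≡sum m g | Σ≡sum m h = ∑-distrib-+ g h

  *-distribˡ-Σ : ∀ m x (g : Fin m → Carrier) → x * Σ m g ≈ Σ m (λ t → x * g t)
  *-distribˡ-Σ m x g rewrite Σ≡sum m g | Σ≡sum m (λ t → x * g t) = *-distribˡ-sum x g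

  Σ-zero : ∀ m → Σ m (λ _ → 0#) ≈ 0#
  Σ-zero m rewrite Σ≡sum m (λ _ → 0#) = sum-replicate-zero m

  Σ-init-last : ∀ m (g : Fin (suc m) → Carrier) →
                Σ (suc m) g ≈ Σ m (λ t → g (Fin.inject₁ t)) + g (Fin.fromℕ m)
  Σ-init-last m g
    rewrite Σ≡sum (suc m) g | Σ≡sum m (λ t → g (Fin.inject₁ t)) = sum-init-last g

  Σ-*-Iₘ : ∀ m (g : Fin m → Carrier) s → Σ m (λ t → g t * Iₘ t s) ≈ g s
  Σ-*-Iₘ (suc m) g Fin.zero = begin
    g Fin.zero * 1# + Σ m (λ t → g (Fin.suc t) * 0#) ≈⟨ +-cong (*-identityʳ _) (Σ-cong m (λ t → zeroʳ _)) ⟩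
    g Fin.zero + Σ m (λ _ → 0#)                      ≈⟨ +-congˡ (Σ-zero m) ⟩
    g Fin.zero + 0#                                  ≈⟨ +-identityʳ _ ⟩
    g Fin.zero                                       ∎
    where open import Relation.Binary.Reasoning.Setoid setoid
  Σ-*-Iₘ (suc m) g (Fin.suc s) =
    trans (+-cong (zeroʳ _) (Σ-*-Iₘ m (λ t → g (Fin.suc t)) s)) (+-identityˡ _)

  module _ {n : ℕ} where

    *ₘ-congˡ : ∀ (M : Mat n) {N N′ : Mat n} → N ≈ₘ N′ → (M *ₘ N) ≈ₘ (M *ₘ N′)
    *ₘ-congˡ M N≈N′ r s = Σ-cong n (λ t → *-congˡ (N≈N′ t s))

    *ₘ-distribˡ-+ₘ : ∀ (M N N′ : Mat n) → (M *ₘ (N +ₘ N′)) ≈ₘ ((M *ₘ N) +ₘ (M *ₘ N′))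
    *ₘ-distribˡ-+ₘ M N N′ r s = trans (Σ-cong n (λ t → distribˡ _ _ _)) (Σ-distrib-+ n _ _)

    *ₘ-·ₘ : ∀ (M N : Mat n) x → (M *ₘ (x ·ₘ N)) ≈ₘ (x ·ₘ (M *ₘ N))
    *ₘ-·ₘ M N x r s =
      trans (Σ-cong n (λ t → x∙yz≈y∙xz (M r t) x (N t s))) (sym (*-distribˡ-Σ n x _))

    *ₘ-zeroʳ : ∀ (M : Mat n) → (M *ₘ 0ₘ) ≈ₘ 0ₘ
    *ₘ-zeroʳ M r s = trans (Σ-cong n (λ t → zeroʳ _)) (Σ-zero n)

    *ₘ-identityʳ : ∀ (M : Mat n) → (M *ₘ Iₘ) ≈ₘ M
    *ₘ-identityʳ M r s = Σ-*-Iₘ n (M r) s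

    *ₘ-Jₘ : ∀ (M : Mat n) {x} → (∀ r → Σ n (M r) ≈ x) → (M *ₘ Jₘ) ≈ₘ (x ·ₘ Jₘ)
    *ₘ-Jₘ M rowSum r s =
      trans (Σ-cong n (λ t → *-identityʳ _)) (trans (rowSum r) (sym (*-identityʳ _)))

module PolynomialProperties {ℓc ℓ₁ ℓ₂} (F : OrderedField ℓc ℓ₁ ℓ₂) where
  open Over F
  open MatrixProperties F
  open import Algebra.Solver.Ring.NaturalCoefficients.Default commutativeSemiring
    using (solve; _:+_; _:*_; _:=_)
  open import Relation.Binary.Reasoning.Setoid setoid

  module _ {n : ℕ} (M : Mat n) where

    eval-+ₚ : ∀ p q → evalₘ (p +ₚ q) M ≈ₘ (evalₘ p M +ₘ evalₘ q M)
    eval-+ₚ []      q       r s = sym (+-identityˡ _)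
    eval-+ₚ (x ∷ p) []      r s = sym (+-identityʳ _)
    eval-+ₚ (x ∷ p) (y ∷ q) r s = begin
      (x + y) * Iₘ r s + (M *ₘ evalₘ (p +ₚ q) M) r s
        ≈⟨ +-congˡ (trans (*ₘ-congˡ M (eval-+ₚ p q) r s) (*ₘ-distribˡ-+ₘ M (evalₘ p M) (evalₘ q M) r s)) ⟩
      (x + y) * Iₘ r s + ((M *ₘ evalₘ p M) r s + (M *ₘ evalₘ q M) r s)
        ≈⟨ [x+y]*i+[u+v]≈[x*i+u]+[y*i+v] x y (Iₘ r s) _ _ ⟩
      (x * Iₘ r s + (M *ₘ evalₘ p M) r s) + (y * Iₘ r s + (M *ₘ evalₘ q M) r s) ∎
      where
      [x+y]*i+[u+v]≈[x*i+u]+[y*i+v] : ∀ x y i u v → (x + y) * i + (u + v) ≈ (x * i + u) + (y * i + v)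
      [x+y]*i+[u+v]≈[x*i+u]+[y*i+v] =
        solve 5 (λ x y i u v → (x :+ y) :* i :+ (u :+ v) := (x :* i :+ u) :+ (y :* i :+ v)) refl

    eval-·ₚ : ∀ x p → evalₘ (x ·ₚ p) M ≈ₘ (x ·ₘ evalₘ p M)
    eval-·ₚ x []      r s = sym (zeroʳ x)
    eval-·ₚ x (y ∷ p) r s = begin
      (x * y) * Iₘ r s + (M *ₘ evalₘ (x ·ₚ p) M) r s
        ≈⟨ +-congˡ (trans (*ₘ-congˡ M (eval-·ₚ x p) r s) (*ₘ-·ₘ M (evalₘ p M) x r s)) ⟩
      (x * y) * Iₘ r s + x * (M *ₘ evalₘ p M) r s
        ≈⟨ +-congʳ (*-assoc x y _) ⟩
      x * (y * Iₘ r s) + x * (M *ₘ evalₘ p M) r s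
        ≈⟨ distribˡ x _ _ ⟨
      x * (y * Iₘ r s + (M *ₘ evalₘ p M) r s) ∎

    eval-shift : ∀ p → evalₘ (0# ∷ p) M ≈ₘ (M *ₘ evalₘ p M)
    eval-shift p r s = trans (+-congʳ (zeroˡ _)) (+-identityˡ _)

    eval-1 : evalₘ (1# ∷ []) M ≈ₘ Iₘ
    eval-1 r s = trans (+-cong (*-identityˡ _) (*ₘ-zeroʳ M r s)) (+-identityʳ _)

    eval-X : evalₘ (0# ∷ 1# ∷ []) M ≈ₘ M
    eval-X r s = trans (eval-shift (1# ∷ []) r s)
                       (trans (*ₘ-congˡ M eval-1 r s) (*ₘ-identityʳ M r s))

    eval-X- : ∀ x → evalₘ (X- x) M ≈ₘ (((- x) ·ₘ Iₘ) +ₘ M)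
    eval-X- x r s = +-congˡ (trans (*ₘ-congˡ M eval-1 r s) (*ₘ-identityʳ M r s))

    eval-*X- : ∀ x p → evalₘ (p *ₚ (X- x)) M ≈ₘ ((M *ₘ evalₘ p M) +ₘ ((- x) ·ₘ evalₘ p M))
    eval-*X- x [] r s = sym (trans (+-cong (*ₘ-zeroʳ M r s) (zeroʳ _)) (+-identityˡ 0#))
    eval-*X- x (y ∷ p) r s = begin
      evalₘ ((y ·ₚ (X- x)) +ₚ (0# ∷ (p *ₚ (X- x)))) M r s
        ≈⟨ eval-+ₚ (y ·ₚ (X- x)) (0# ∷ (p *ₚ (X- x))) r s ⟩
      evalₘ (y ·ₚ (X- x)) M r s + evalₘ (0# ∷ (p *ₚ (X- x))) M r s
        ≈⟨ +-cong (trans (eval-·ₚ y (X- x) r s) (*-congˡ (eval-X- x r s)))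
                  (trans (eval-shift (p *ₚ (X- x)) r s)
                         (trans (*ₘ-congˡ M (eval-*X- x p) r s)
                                (trans (*ₘ-distribˡ-+ₘ M (M *ₘ ep) ((- x) ·ₘ ep) r s)
                                       (+-congˡ (*ₘ-·ₘ M ep (- x) r s))))) ⟩
      y * ((- x) * Iₘ r s + M r s) + ((M *ₘ (M *ₘ ep)) r s + (- x) * (M *ₘ ep) r s)
        ≈⟨ regroup y (- x) (Iₘ r s) (M r s) _ _ ⟩
      (y * M r s + (M *ₘ (M *ₘ ep)) r s) + (- x) * (y * Iₘ r s + (M *ₘ ep) r s)
        ≈⟨ +-congʳ (+-congʳ (trans (*ₘ-·ₘ M Iₘ y r s) (*-congˡ (*ₘ-identityʳ M r s)))) ⟨
      ((M *ₘ (y ·ₘ Iₘ)) r s + (M *ₘ (M *ₘ ep)) r s) + (- x) * (y * Iₘ r s + (M *ₘ ep) r s)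
        ≈⟨ +-congʳ (*ₘ-distribˡ-+ₘ M (y ·ₘ Iₘ) (M *ₘ ep) r s) ⟨
      (M *ₘ evalₘ (y ∷ p) M) r s + (- x) * evalₘ (y ∷ p) M r s ∎
      where
      ep = evalₘ p M
      regroup : ∀ y n i m u v → y * (n * i + m) + (u + n * v) ≈ (y * m + u) + n * (y * i + v)
      regroup = solve 6 (λ y n i m u v → y :* (n :* i :+ m) :+ (u :+ n :* v)
                                      := (y :* m :+ u) :+ n :* (y :* i :+ v)) refl

  coeff-+ₚ : ∀ p q j → coeff (p +ₚ q) j ≈ coeff p j + coeff q j
  coeff-+ₚ []      q       j       = sym (+-identityˡ _)
  coeff-+ₚ (x ∷ p) []      j       = sym (+-identityʳ _)
  coeff-+ₚ (x ∷ p) (y ∷ q) zero    = refl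
  coeff-+ₚ (x ∷ p) (y ∷ q) (suc j) = coeff-+ₚ p q j

  coeff-·ₚ : ∀ x p j → coeff (x ·ₚ p) j ≈ x * coeff p j
  coeff-·ₚ x []      j       = sym (zeroʳ x)
  coeff-·ₚ x (y ∷ p) zero    = refl
  coeff-·ₚ x (y ∷ p) (suc j) = coeff-·ₚ x p j

  coeff-*-linear₀ : ∀ p u v → coeff (p *ₚ (u ∷ v ∷ [])) 0 ≈ coeff p 0 * u
  coeff-*-linear₀ []      u v = sym (zeroˡ u)
  coeff-*-linear₀ (x ∷ p) u v = +-identityʳ _

  coeff-*-linear : ∀ p u v j →
    coeff (p *ₚ (u ∷ v ∷ [])) (suc j) ≈ coeff p j * v + coeff p (suc j) * u
  coeff-*-linear []      u v j = sym (trans (+-cong (zeroˡ v) (zeroˡ u)) (+-identityʳ 0#))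
  coeff-*-linear (x ∷ p) u v j =
    trans (coeff-+ₚ (x ·ₚ (u ∷ v ∷ [])) (0# ∷ (p *ₚ (u ∷ v ∷ []))) (suc j)) (summands j)
    where
    summands : ∀ j → coeff (x ·ₚ (u ∷ v ∷ [])) (suc j) + coeff (p *ₚ (u ∷ v ∷ [])) j ≈
                     coeff (x ∷ p) j * v + coeff (x ∷ p) (suc j) * u
    summands zero    = +-congˡ (coeff-*-linear₀ p u v)
    summands (suc j) = trans (+-identityˡ _) (coeff-*-linear p u v j)

  DegreeAtMost : ℕ → Poly → Set ℓ₁
  DegreeAtMost m p = ∀ j → m <ℕ j → coeff p j ≈ 0#

  ·ₚ-degreeAtMost : ∀ {m} x p → DegreeAtMost m p → DegreeAtMost m (x ·ₚ p)
  ·ₚ-degreeAtMost x p deg j m<j = trans (coeff-·ₚ x p j) (trans (*-congˡ (deg j m<j)) (zeroʳ x))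

  *X-‿degreeAtMost : ∀ {m} x p → DegreeAtMost m p → DegreeAtMost (suc m) (p *ₚ (X- x))
  *X-‿degreeAtMost x p deg (suc j) (s≤s m<j) = begin
    coeff (p *ₚ (X- x)) (suc j)             ≈⟨ coeff-*-linear p (- x) 1# j ⟩
    coeff p j * 1# + coeff p (suc j) * - x  ≈⟨ +-cong (*-congʳ (deg j m<j)) (*-congʳ (deg (suc j) (ℕ.m<n⇒m<1+n m<j))) ⟩
    0# * 1# + 0# * - x                      ≈⟨ trans (+-cong (zeroˡ _) (zeroˡ _)) (+-identityʳ 0#) ⟩
    0#                                      ∎

  *X-‿lead : ∀ {m} x p → DegreeAtMost m p → coeff (p *ₚ (X- x)) (suc m) ≈ coeff p m
  *X-‿lead {m} x p deg = begin
    coeff (p *ₚ (X- x)) (suc m)             ≈⟨ coeff-*-linear p (- x) 1# m ⟩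
    coeff p m * 1# + coeff p (suc m) * - x  ≈⟨ +-cong (*-identityʳ _) (*-congʳ (deg (suc m) (ℕ.n<1+n m))) ⟩
    coeff p m + 0# * - x                    ≈⟨ trans (+-congˡ (zeroˡ _)) (+-identityʳ _) ⟩
    coeff p m                               ∎

  sumₚ : (ℕ → Poly) → ℕ → Poly
  sumₚ p zero    = p 0
  sumₚ p (suc m) = sumₚ p m +ₚ p (suc m)

  module _ (p : ℕ → Poly) (deg : ∀ i → DegreeAtMost i (p i)) where

    sumₚ-degreeAtMost : ∀ m → DegreeAtMost m (sumₚ p m)
    sumₚ-degreeAtMost zero    = deg 0
    sumₚ-degreeAtMost (suc m) j m<j = begin
      coeff (sumₚ p m +ₚ p (suc m)) j          ≈⟨ coeff-+ₚ (sumₚ p m) (p (suc m)) j ⟩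
      coeff (sumₚ p m) j + coeff (p (suc m)) j ≈⟨ +-cong (sumₚ-degreeAtMost m j (ℕ.<-trans (ℕ.n<1+n m) m<j))
                                                         (deg (suc m) j m<j) ⟩
      0# + 0#                                  ≈⟨ +-identityʳ 0# ⟩
      0#                                       ∎

    sumₚ-lead : ∀ m → coeff (sumₚ p m) m ≈ coeff (p m) m
    sumₚ-lead zero    = refl
    sumₚ-lead (suc m) = trans (coeff-+ₚ (sumₚ p m) (p (suc m)) (suc m))
      (trans (+-congʳ (sumₚ-degreeAtMost m (suc m) (ℕ.n<1+n m))) (+-identityˡ _))

  eval-sumₚ : ∀ {n} (M : Mat n) p m r s →
              evalₘ (sumₚ p m) M r s ≈ Σ (suc m) (λ i → evalₘ (p (toℕ i)) M r s)
  eval-sumₚ M p zero    r s = sym (+-identityʳ _)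
  eval-sumₚ M p (suc m) r s = begin
    evalₘ (sumₚ p m +ₚ p (suc m)) M r s
      ≈⟨ eval-+ₚ M (sumₚ p m) (p (suc m)) r s ⟩
    evalₘ (sumₚ p m) M r s + evalₘ (p (suc m)) M r s
      ≈⟨ +-cong (trans (eval-sumₚ M p m r s)
                       (Σ-cong (suc m) (λ i → reflexive (≡.cong e (≡.sym (Fin.toℕ-inject₁ i))))))
                (reflexive (≡.cong e (≡.sym (Fin.toℕ-fromℕ (suc m))))) ⟩
    Σ (suc m) (λ i → e (toℕ (Fin.inject₁ i))) + e (toℕ (Fin.fromℕ (suc m)))
      ≈⟨ Σ-init-last (suc m) (λ i → e (toℕ i)) ⟨
    Σ (suc (suc m)) (λ i → e (toℕ i)) ∎
    where
    e : ℕ → Carrier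
    e i = evalₘ (p i) M r s

module ThreeTermRecurrence {ℓc ℓ₁ ℓ₂} (F : OrderedField ℓc ℓ₁ ℓ₂) where
  open Over F
  open MatrixProperties F
  open PolynomialProperties F
  open import Algebra.Solver.Ring.NaturalCoefficients.Default commutativeSemiring
    using (solve; _:+_; _:*_; _:=_; con)
  open import Algebra.Properties.CommutativeSemigroup *-commutativeSemigroup using (interchange)
  open import Relation.Binary.Reasoning.Setoid setoid

  recurrenceStep : Carrier → Carrier → Poly → Poly → Poly
  recurrenceStep x y p q = ((0# ∷ q) +ₚ (x ·ₚ q)) +ₚ (y ·ₚ p)

  coeff-recurrenceStep : ∀ x y p q j →
    coeff (recurrenceStep x y p q) (suc j) ≈ (coeff q j + x * coeff q (suc j)) + y * coeff p (suc j)
  coeff-recurrenceStep x y p q j =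
    trans (coeff-+ₚ ((0# ∷ q) +ₚ (x ·ₚ q)) (y ·ₚ p) (suc j))
      (+-cong (trans (coeff-+ₚ (0# ∷ q) (x ·ₚ q) (suc j)) (+-congˡ (coeff-·ₚ x q (suc j))))
              (coeff-·ₚ y p (suc j)))

  eval-recurrenceStep : ∀ {n} (M : Mat n) x y p q →
    evalₘ (recurrenceStep x y p q) M ≈ₘ
      (((M *ₘ evalₘ q M) +ₘ (x ·ₘ evalₘ q M)) +ₘ (y ·ₘ evalₘ p M))
  eval-recurrenceStep M x y p q r s =
    trans (eval-+ₚ M ((0# ∷ q) +ₚ (x ·ₚ q)) (y ·ₚ p) r s)
      (+-cong (trans (eval-+ₚ M (0# ∷ q) (x ·ₚ q) r s) (+-cong (eval-shift M q r s) (eval-·ₚ M x q r s)))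
              (eval-·ₚ M y p r s))

  x*[y+z*0+w*0]≈x*y : ∀ x y z w → x * ((y + z * 0#) + w * 0#) ≈ x * y
  x*[y+z*0+w*0]≈x*y = solve 4 (λ x y z w → x :* ((y :+ z :* con 0) :+ w :* con 0) := x :* y) refl

  solve-for-last : ∀ {g α β κ} x y z → κ * g ≈ 1# →
                   g * ((((β * x + α * y) + κ * z) + - α * y) + - β * x) ≈ z
  solve-for-last {g} {α} {β} {κ} x y z κ*g≈1 = begin
    g * ((((β * x + α * y) + κ * z) + - α * y) + - β * x)
      ≈⟨ regroup g α β κ x y z (- α) (- β) ⟩
    (κ * g) * z + g * ((α + - α) * y + (β + - β) * x)
      ≈⟨ +-cong (*-congʳ κ*g≈1) (*-congˡ (+-cong (*-congʳ (-‿inverseʳ α)) (*-congʳ (-‿inverseʳ β)))) ⟩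
    1# * z + g * (0# * y + 0# * x)
      ≈⟨ simplify g x y z ⟩
    z ∎
    where
    regroup : ∀ g α β κ x y z α′ β′ →
      g * ((((β * x + α * y) + κ * z) + α′ * y) + β′ * x) ≈ (κ * g) * z + g * ((α + α′) * y + (β + β′) * x)
    regroup = solve 9 (λ g α β κ x y z α′ β′ →
      g :* ((((β :* x :+ α :* y) :+ κ :* z) :+ α′ :* y) :+ β′ :* x)
        := (κ :* g) :* z :+ g :* ((α :+ α′) :* y :+ (β :+ β′) :* x)) refl
    simplify : ∀ g x y z → 1# * z + g * (0# * y + 0# * x) ≈ z
    simplify = solve 4 (λ g x y z → con 1 :* z :+ g :* (con 0 :* y :+ con 0 :* x) := z) refl

  -- γ i plays the role of 1 / c_{i+2}: the recurrence of the setting, solved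
  -- for A_{i+2}, read as a recurrence for polynomials.
  module Polynomials (a b γ : ℕ → Carrier) where

    P : ℕ → Poly
    P zero          = 1# ∷ []
    P (suc zero)    = 0# ∷ 1# ∷ []
    P (suc (suc i)) = γ i ·ₚ recurrenceStep (- a (suc i)) (- b i) (P i) (P (suc i))

    coeff-P : ∀ i j → coeff (P (suc (suc i))) (suc j) ≈
      γ i * ((coeff (P (suc i)) j + - a (suc i) * coeff (P (suc i)) (suc j)) + - b i * coeff (P i) (suc j))
    coeff-P i j = trans (coeff-·ₚ (γ i) (recurrenceStep (- a (suc i)) (- b i) (P i) (P (suc i))) (suc j))
                        (*-congˡ (coeff-recurrenceStep (- a (suc i)) (- b i) (P i) (P (suc i)) j))

    P-degreeAtMost : ∀ i → DegreeAtMost i (P i)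
    P-degreeAtMost zero          (suc j)             _ = refl
    P-degreeAtMost (suc zero)    (suc (suc j))       _ = refl
    P-degreeAtMost (suc zero)    (suc zero)          (s≤s ())
    P-degreeAtMost (suc (suc i)) (suc j) (s≤s 2+i<j) = begin
      coeff (P (suc (suc i))) (suc j)
        ≈⟨ coeff-P i j ⟩
      γ i * ((coeff (P (suc i)) j + - a (suc i) * coeff (P (suc i)) (suc j)) + - b i * coeff (P i) (suc j))
        ≈⟨ *-congˡ (+-cong (+-cong (P-degreeAtMost (suc i) j 2+i<j)
                                   (*-congˡ (P-degreeAtMost (suc i) (suc j) (ℕ.m<n⇒m<1+n 2+i<j))))
                           (*-congˡ (P-degreeAtMost i (suc j) (ℕ.<-trans (ℕ.n<1+n i) (ℕ.m<n⇒m<1+n 2+i<j))))) ⟩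
      γ i * ((0# + - a (suc i) * 0#) + - b i * 0#)
        ≈⟨ trans (x*[y+z*0+w*0]≈x*y (γ i) 0# _ _) (zeroʳ (γ i)) ⟩
      0# ∎

    P-lead : ∀ i → coeff (P (suc (suc i))) (suc (suc i)) ≈ γ i * coeff (P (suc i)) (suc i)
    P-lead i = begin
      coeff (P (suc (suc i))) (suc (suc i))
        ≈⟨ coeff-P i (suc i) ⟩
      γ i * ((ℓ + - a (suc i) * coeff (P (suc i)) (suc (suc i))) + - b i * coeff (P i) (suc (suc i)))
        ≈⟨ *-congˡ (+-cong (+-congˡ (*-congˡ (P-degreeAtMost (suc i) (suc (suc i)) (ℕ.n<1+n _))))
                           (*-congˡ (P-degreeAtMost i (suc (suc i)) (ℕ.<-trans (ℕ.n<1+n i) (ℕ.n<1+n _))))) ⟩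
      γ i * ((ℓ + - a (suc i) * 0#) + - b i * 0#)
        ≈⟨ x*[y+z*0+w*0]≈x*y (γ i) ℓ _ _ ⟩
      γ i * ℓ ∎
      where ℓ = coeff (P (suc i)) (suc i)

    module Normalisation (c : ℕ → Carrier) (d : ℕ)
             (γ-inverse : ∀ i → suc (suc i) ≤ℕ d → c (suc (suc i)) * γ i ≈ 1#) where

      Πc*lead[P]≈1 : c 1 ≈ 1# → ∀ i → i ≤ℕ d → Πℕ i (λ j → c (suc j)) * coeff (P i) i ≈ 1#
      Πc*lead[P]≈1 c₁≈1 zero          _   = *-identityˡ 1#
      Πc*lead[P]≈1 c₁≈1 (suc zero)    _   = trans (*-identityʳ _) (trans (*-identityʳ _) c₁≈1)
      Πc*lead[P]≈1 c₁≈1 (suc (suc i)) 2+i≤d = begin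
        (c (suc (suc i)) * Π) * coeff (P (suc (suc i))) (suc (suc i)) ≈⟨ *-congˡ (P-lead i) ⟩
        (c (suc (suc i)) * Π) * (γ i * coeff (P (suc i)) (suc i))     ≈⟨ interchange _ Π _ _ ⟩
        (c (suc (suc i)) * γ i) * (Π * coeff (P (suc i)) (suc i))     ≈⟨ *-cong (γ-inverse i 2+i≤d)
                                                                                  (Πc*lead[P]≈1 c₁≈1 (suc i) (ℕ.<⇒≤ 2+i≤d)) ⟩
        1# * 1#                                                       ≈⟨ *-identityˡ 1# ⟩
        1#                                                            ∎
        where Π = Πℕ (suc i) (λ j → c (suc j))

      module _ {n} (M : Mat n) (Q : ℕ → Mat n) (Q₀≈I : Q 0 ≈ₘ Iₘ) (Q₁≈M : Q 1 ≈ₘ M)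
               (recurrence : ∀ i → suc (suc i) ≤ℕ d →
                 (M *ₘ Q (suc i)) ≈ₘ
                   (((b i ·ₘ Q i) +ₘ (a (suc i) ·ₘ Q (suc i))) +ₘ (c (suc (suc i)) ·ₘ Q (suc (suc i))))) where

        eval-P : ∀ i → i ≤ℕ d → evalₘ (P i) M ≈ₘ Q i
        eval-P zero          _   r s = trans (eval-1 M r s) (sym (Q₀≈I r s))
        eval-P (suc zero)    _   r s = trans (eval-X M r s) (sym (Q₁≈M r s))
        eval-P (suc (suc i)) 2+i≤d r s = begin
          evalₘ (γ i ·ₚ step) M r s
            ≈⟨ trans (eval-·ₚ M (γ i) step r s)
                     (*-congˡ (eval-recurrenceStep M (- a (suc i)) (- b i) (P i) (P (suc i)) r s)) ⟩
          γ i * (((M *ₘ evalₘ (P (suc i)) M) r s + - a (suc i) * evalₘ (P (suc i)) M r s) + - b i * evalₘ (P i) M r s)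
            ≈⟨ *-congˡ (+-cong (+-cong (*ₘ-congˡ M (eval-P (suc i) 1+i≤d) r s) (*-congˡ (eval-P (suc i) 1+i≤d r s)))
                               (*-congˡ (eval-P i i≤d r s))) ⟩
          γ i * (((M *ₘ Q (suc i)) r s + - a (suc i) * Q (suc i) r s) + - b i * Q i r s)
            ≈⟨ *-congˡ (+-congʳ (+-congʳ (recurrence i 2+i≤d r s))) ⟩
          γ i * ((((b i * Q i r s + a (suc i) * Q (suc i) r s) + c (suc (suc i)) * Q (suc (suc i)) r s)
                 + - a (suc i) * Q (suc i) r s) + - b i * Q i r s)
            ≈⟨ solve-for-last (Q i r s) (Q (suc i) r s) (Q (suc (suc i)) r s) (γ-inverse i 2+i≤d) ⟩
          Q (suc (suc i)) r s ∎
          where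
          step = recurrenceStep (- a (suc i)) (- b i) (P i) (P (suc i))
          1+i≤d : suc i ≤ℕ d
          1+i≤d = ℕ.<⇒≤ 2+i≤d
          i≤d : i ≤ℕ d
          i≤d = ℕ.≤-trans (ℕ.n≤1+n i) 1+i≤d

module DistanceRegular {ℓc ℓ₁ ℓ₂} (F : OrderedField ℓc ℓ₁ ℓ₂) where
  open Over F
  open OrderedFieldProperties F
  open MatrixProperties F
  open PolynomialProperties F
  open ThreeTermRecurrence F
  open IsTotalOrder isTotalOrder using () renaming (reflexive to ≤-reflexive; trans to ≤-trans)
  open import Relation.Binary.Reasoning.Setoid setoid

  module Setting
    (n d k : ℕ) (c a b : ℕ → Carrier) (c₁≈1 : c 1 ≈ 1#)
    (c-mono : ∀ i → 1 ≤ℕ i → suc i ≤ℕ d → c i ≤ c (suc i))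
    (A : Mat n) (Aᵢ : ℕ → Mat n) (A₀≈I : Aᵢ 0 ≈ₘ Iₘ) (A₁≈A : Aᵢ 1 ≈ₘ A)
    (rowSum≈k : ∀ r → Σ n (λ s → A r s) ≈ ι k)
    (ΣAᵢ≈J : ∀ r s → Σ (suc d) (λ i → Aᵢ (toℕ i) r s) ≈ 1#)
    (recurrence : ∀ i → suc i ≤ℕ d →
       (A *ₘ Aᵢ (suc i)) ≈ₘ
         (((b i ·ₘ Aᵢ i) +ₘ (a (suc i) ·ₘ Aᵢ (suc i))) +ₘ (c (suc (suc i)) ·ₘ Aᵢ (suc (suc i)))))
    where
    1≤c : ∀ m → 1 ≤ℕ m → m ≤ℕ d → 1# ≤ c m
    1≤c (suc zero)    _ _   = ≤-reflexive (sym c₁≈1)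
    1≤c (suc (suc m)) _ m≤d =
      ≤-trans (1≤c (suc m) (s≤s z≤n) (ℕ.<⇒≤ m≤d)) (c-mono (suc m) (s≤s z≤n) m≤d)

    γ-spec : ∃ λ γ → ∀ i → suc (suc i) ≤ℕ d → c (suc (suc i)) * γ i ≈ 1#
    γ-spec = inverseOn (λ i → suc (suc i) ≤? d) (λ i → c (suc (suc i)))
                       (λ i 2+i≤d → 1≤x⇒x≉0 (1≤c (suc (suc i)) (s≤s z≤n) 2+i≤d))

    γ : ℕ → Carrier
    γ = proj₁ γ-spec

    γ-inverse : ∀ i → suc (suc i) ≤ℕ d → c (suc (suc i)) * γ i ≈ 1#
    γ-inverse = proj₂ γ-spec

    open Polynomials a b γ
    open Normalisation c d γ-inverse

    C : Carrier
    C = Πℕ d (λ j → c (suc j))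

    eval-P≈Aᵢ : ∀ i → i ≤ℕ d → evalₘ (P i) A ≈ₘ Aᵢ i
    eval-P≈Aᵢ = eval-P A Aᵢ A₀≈I A₁≈A (λ i 2+i≤d → recurrence i (ℕ.<⇒≤ 2+i≤d))

    P-degree : ∀ i → i ≤ℕ d → Degree (P i) i
    P-degree i i≤d = lead≉0 , P-degreeAtMost i
      where
      lead≉0 : ¬ (coeff (P i) i ≈ 0#)
      lead≉0 lead≈0 = 0≉1 (trans (sym (trans (*-congˡ lead≈0) (zeroʳ _))) (Πc*lead[P]≈1 c₁≈1 i i≤d))

    Aᵢ-polynomial : ∀ i → i ≤ℕ d → ∃ λ p → Degree p i × (evalₘ p A ≈ₘ Aᵢ i)
    Aᵢ-polynomial i i≤d = P i , P-degree i i≤d , eval-P≈Aᵢ i i≤d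

    f : Poly
    f = sumₚ P d

    f-degreeAtMost : DegreeAtMost d f
    f-degreeAtMost = sumₚ-degreeAtMost P P-degreeAtMost d

    f-degree : Degree f d
    f-degree = (λ lead≈0 → proj₁ (P-degree d ℕ.≤-refl) (trans (sym (sumₚ-lead P P-degreeAtMost d)) lead≈0)) ,
               f-degreeAtMost

    eval-f≈J : evalₘ f A ≈ₘ Jₘ
    eval-f≈J r s = begin
      evalₘ f A r s
        ≈⟨ eval-sumₚ A P d r s ⟩
      Σ (suc d) (λ i → evalₘ (P (toℕ i)) A r s)
        ≈⟨ Σ-cong (suc d) (λ i → eval-P≈Aᵢ (toℕ i) (Fin.toℕ≤pred[n] i) r s) ⟩
      Σ (suc d) (λ i → Aᵢ (toℕ i) r s)
        ≈⟨ ΣAᵢ≈J r s ⟩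
      1# ∎

    μ : Poly
    μ = C ·ₚ (f *ₚ (X- ι k))

    μ-monic : coeff μ (suc d) ≈ 1#
    μ-monic = begin
      coeff μ (suc d)                   ≈⟨ coeff-·ₚ C (f *ₚ (X- ι k)) (suc d) ⟩
      C * coeff (f *ₚ (X- ι k)) (suc d) ≈⟨ *-congˡ (*X-‿lead (ι k) f f-degreeAtMost) ⟩
      C * coeff f d                     ≈⟨ *-congˡ (sumₚ-lead P P-degreeAtMost d) ⟩
      C * coeff (P d) d                 ≈⟨ Πc*lead[P]≈1 c₁≈1 d ℕ.≤-refl ⟩
      1#                                ∎

    μ-degree : Degree μ (suc d)
    μ-degree = (λ μ≈0 → 0≉1 (trans (sym μ≈0) μ-monic)) ,
               ·ₚ-degreeAtMost C (f *ₚ (X- ι k)) (*X-‿degreeAtMost (ι k) f f-degreeAtMost)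

    eval-μ≈0 : evalₘ μ A ≈ₘ 0ₘ
    eval-μ≈0 r s = begin
      evalₘ μ A r s
        ≈⟨ eval-·ₚ A C (f *ₚ (X- ι k)) r s ⟩
      C * evalₘ (f *ₚ (X- ι k)) A r s
        ≈⟨ *-congˡ (eval-*X- A (ι k) f r s) ⟩
      C * ((A *ₘ evalₘ f A) r s + - ι k * evalₘ f A r s)
        ≈⟨ *-congˡ (+-cong (trans (*ₘ-congˡ A eval-f≈J r s) (*ₘ-Jₘ A rowSum≈k r s)) (*-congˡ (eval-f≈J r s))) ⟩
      C * (ι k * 1# + - ι k * 1#)
        ≈⟨ *-congˡ (trans (sym (distribʳ 1# (ι k) (- ι k))) (trans (*-identityʳ _) (-‿inverseʳ (ι k)))) ⟩
      C * 0#
        ≈⟨ zeroʳ C ⟩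
      0# ∎

lemma1 : ∀ {ℓc ℓ₁ ℓ₂} (F : OrderedField ℓc ℓ₁ ℓ₂) → let open Over F in
  (n d k : ℕ) → 2 ≤ℕ d → 3 ≤ℕ k →
  (c a b : ℕ → Carrier) →
  -- boundary values (the index -1 values c₋₁ = b₋₁ = 0 are built into the i = 0 recurrence)
  c 0 ≈ 0# → c 1 ≈ 1# → c (suc d) ≈ 0# →
  b 0 ≈ ι k → b d ≈ 0# → b (suc d) ≈ 0# → a 0 ≈ 0# →
  (∀ i → i ≤ℕ suc d → ι k ≈ c i + a i + b i) →
  -- 1 = c₁ ≤ c₂ ≤ ⋯ ≤ c_d ≤ k
  (∀ i → 1 ≤ℕ i → suc i ≤ℕ d → c i ≤ c (suc i)) → c d ≤ ι k →
  -- k = b₀ ≥ b₁ ≥ ⋯ ≥ b_{d-1} ≥ 1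
  (∀ i → suc i ≤ℕ d ∸ 1 → b (suc i) ≤ b i) → 1# ≤ b (d ∸ 1) →
  (A : Mat n) (Aᵢ : ℕ → Mat n) →
  Aᵢ 0 ≈ₘ Iₘ → Aᵢ 1 ≈ₘ A → Aᵢ (suc d) ≈ₘ 0ₘ →
  -- A 𝐣 = k 𝐣
  (∀ r → Σ n (λ s → A r s) ≈ ι k) →
  MinPolyDegAtLeast A (suc d) →
  -- J = A₀ + A₁ + ⋯ + A_d
  (∀ r s → Σ (suc d) (λ i → Aᵢ (toℕ i) r s) ≈ 1#) →
  -- A A₀ = b₋₁ A₋₁ + a₀ A₀ + c₁ A₁   with b₋₁ A₋₁ = 0
  (A *ₘ Aᵢ 0) ≈ₘ ((a 0 ·ₘ Aᵢ 0) +ₘ (c 1 ·ₘ Aᵢ 1)) →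
  -- A A_i = b_{i-1} A_{i-1} + a_i A_i + c_{i+1} A_{i+1}   for 1 ≤ i ≤ d
  (∀ i → suc i ≤ℕ d →
     (A *ₘ Aᵢ (suc i)) ≈ₘ
       (((b i ·ₘ Aᵢ i) +ₘ (a (suc i) ·ₘ Aᵢ (suc i))) +ₘ (c (suc (suc i)) ·ₘ Aᵢ (suc (suc i))))) →
  -- conclusions
  (∀ i → i ≤ℕ d → ∃ λ p → Degree p i × (evalₘ p A ≈ₘ Aᵢ i)) ×
  (∃ λ f → Degree f d × (evalₘ f A ≈ₘ Jₘ) ×
     IsMinPoly A (Πℕ d (λ j → c (suc j)) ·ₚ (f *ₚ (X- ι k))) (suc d))
lemma1 F n d k _ _ c a b _ c₁≈1 _ _ _ _ _ _ c-mono _ _ _ A Aᵢ A₀≈I A₁≈A _ rowSum≈k minDeg ΣAᵢ≈J _ recurrence =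
  Aᵢ-polynomial ,
  (f , f-degree , eval-f≈J , μ-degree , μ-monic , eval-μ≈0 , minDeg)
  where
  open DistanceRegular F
  open Setting n d k c a b c₁≈1 c-mono A Aᵢ A₀≈I A₁≈A rowSum≈k ΣAᵢ≈J recurrence
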